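{- Let $A$ be a complete MV-algebra and let $j:A\to A$ be a nucleus that is inductive and of MV-type. Then the set of fixed points $jA$ is a complete MV-algebra (a sub-MV-algebra of $A$) which is algebraic as a frame.
   Context: A closure operator on $A$ is a map $j:A\to A$ that is extensive ($x\le j(x)$), monotone and idempotent; $jA=\{x\in A:j(x)=x\}$. A nucleus is a closure operator with $j(a\wedge b)=j(a)\wedge j(b)$. $j$ is of MV-type if $jA$ is closed under $\neg$ and $\oplus$. $j$ is inductive if $j(x)=\bigvee\{j(a):a\in\mathfrak{k}(A),\ a\le x\}$ for all $x\in A$, where $\mathfrak{k}(L)$ is the set of compact elements of a complete lattice $L$ ($a$ is compact if whenever $a\le\bigvee S$ there is a finite $F\subseteq S$ with $a\le\bigvee F$). $L$ is algebraic if every element is the join of the compact elements below it. -}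

module Defs where

open import Level using (Level; suc; _⊔_)
open import Data.Unit.Polymorphic using (⊤)
open import Data.Product using (Σ; ∃; ∃-syntax; _×_; _,_)
open import Data.List using (List; foldr)
open import Data.List.Relation.Unary.All using (All)
open import Relation.Binary.PropositionalEquality using (_≡_)

record MVAlgebra (c : Level) : Set (suc c) where
  infixl 6 _⊕_
  infix 8 ¬_
  infixl 5 _∨_
  infixl 5 _∧_
  infix 4 _≤_
  field
    Carrier : Set c
    _⊕_     : Carrier → Carrier → Carrier
    ¬_      : Carrier → Carrier
    0#      : Carrier
    ⊕-assoc : ∀ x y z → (x ⊕ y) ⊕ z ≡ x ⊕ (y ⊕ z)
    ⊕-comm  : ∀ x y → x ⊕ y ≡ y ⊕ x
    ⊕-zero  : ∀ x → x ⊕ 0# ≡ x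
    ¬¬      : ∀ x → ¬ (¬ x) ≡ x
    ⊕-¬0    : ∀ x → x ⊕ ¬ 0# ≡ ¬ 0#
    łuk     : ∀ x y → ¬ (¬ x ⊕ y) ⊕ y ≡ ¬ (¬ y ⊕ x) ⊕ x

  1# : Carrier
  1# = ¬ 0#

  _∨_ : Carrier → Carrier → Carrier
  x ∨ y = ¬ (¬ x ⊕ y) ⊕ y

  _∧_ : Carrier → Carrier → Carrier
  x ∧ y = ¬ (¬ x ∨ ¬ y)

  _≤_ : Carrier → Carrier → Set c
  x ≤ y = ¬ x ⊕ y ≡ 1#

  Pred : Set (suc c)
  Pred = Carrier → Set c

  _⊆_ : Pred → Pred → Set c
  S ⊆ P = ∀ x → S x → P x

  -- everything is relative to a subset P, whose order is the restriction of ≤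
  -- (for the whole algebra take P = Full)
  Full : Pred
  Full _ = ⊤

  -- s is the supremum of S in the poset (P, ≤)
  -- (S may live in any universe level, e.g. the set of compact elements)
  SupIn : ∀ {ℓ} → Pred → (Carrier → Set ℓ) → Carrier → Set (c ⊔ ℓ)
  SupIn P S s = P s × (∀ y → S y → y ≤ s)
                    × (∀ u → P u → (∀ y → S y → y ≤ u) → s ≤ u)

  CompleteIn : Pred → Set (suc c)
  CompleteIn P = ∀ (S : Pred) → S ⊆ P → ∃[ s ] SupIn P S s

  ⋁fin : List Carrier → Carrier
  ⋁fin = foldr _∨_ 0#

  CompactIn : Pred → Carrier → Set (suc c)
  CompactIn P a = P a × (∀ (S : Pred) s → S ⊆ P → SupIn P S s → a ≤ s →
                          ∃[ F ] (All S F × a ≤ ⋁fin F))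

  AlgebraicIn : Pred → Set (suc c)
  AlgebraicIn P = ∀ x → P x → SupIn P (λ a → CompactIn P a × a ≤ x) x

  FrameIn : Pred → Set (suc c)
  FrameIn P = ∀ x (S : Pred) s → P x → S ⊆ P → SupIn P S s →
              SupIn P (λ y → ∃[ z ] (S z × y ≡ x ∧ z)) (x ∧ s)

  IsSubMV : Pred → Set c
  IsSubMV P = P 0# × (∀ x → P x → P (¬ x)) × (∀ x y → P x → P y → P (x ⊕ y))

  IsComplete : Set (suc c)
  IsComplete = CompleteIn Full

  Compact : Carrier → Set (suc c)
  Compact = CompactIn Full

  IsClosureOperator : (Carrier → Carrier) → Set c
  IsClosureOperator j = (∀ x → x ≤ j x) × (∀ x y → x ≤ y → j x ≤ j y)
                        × (∀ x → j (j x) ≡ j x)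

  IsNucleus : (Carrier → Carrier) → Set c
  IsNucleus j = IsClosureOperator j × (∀ a b → j (a ∧ b) ≡ j a ∧ j b)

  Fix : (Carrier → Carrier) → Pred
  Fix j x = j x ≡ x

  IsMVType : (Carrier → Carrier) → Set c
  IsMVType j = (∀ x → Fix j x → Fix j (¬ x))
               × (∀ x y → Fix j x → Fix j y → Fix j (x ⊕ y))

  IsInductive : (Carrier → Carrier) → Set (suc c)
  IsInductive j = ∀ x → SupIn Full (λ y → ∃[ a ] (Compact a × a ≤ x × y ≡ j a)) (j x)

{-# OPTIONS --safe #-}
-- For a family S of fixed points with supremum m in A, every compact b ≤ m lies below a
-- finite join of S, which is fixed; so inductiveness gives j m ≤ m.  Hence suprema in jA
-- are computed in A, which makes jA complete and sends compact a to compact j a; algebraicity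
-- is then inductiveness read in jA.  The frame law holds in every sub-MV-algebra, since
-- x ∧ y = y ⊙ (¬ y ⊕ x) and ⊙ is residuated.
module Submission where

open import Level using (Level)
open import Data.Product using (_×_; _,_; proj₁; proj₂; ∃-syntax)
open import Data.Unit.Polymorphic using (tt)
open import Data.List.Relation.Unary.All as All using (All; []; _∷_)
open import Relation.Binary.PropositionalEquality
open import Defs

module MVProperties {c : Level} (A : MVAlgebra c) where
  open MVAlgebra A
  open ≡-Reasoning

  ¬1≡0 : ¬ 1# ≡ 0#
  ¬1≡0 = ¬¬ 0#

  ⊕-identityˡ : ∀ x → 0# ⊕ x ≡ x
  ⊕-identityˡ x = trans (⊕-comm 0# x) (⊕-zero x)

  ⊕-zeroˡ : ∀ x → 1# ⊕ x ≡ 1#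
  ⊕-zeroˡ x = trans (⊕-comm 1# x) (⊕-¬0 x)

  ≤-refl : ∀ x → x ≤ x
  ≤-refl x = begin
    ¬ x ⊕ x            ≡⟨ cong (λ t → ¬ t ⊕ x) (sym (⊕-identityˡ x)) ⟩
    ¬ (0# ⊕ x) ⊕ x     ≡⟨ cong (λ t → ¬ (t ⊕ x) ⊕ x) (sym ¬1≡0) ⟩
    ¬ (¬ 1# ⊕ x) ⊕ x   ≡⟨ łuk 1# x ⟩
    ¬ (¬ x ⊕ 1#) ⊕ 1#  ≡⟨ ⊕-¬0 _ ⟩
    1#                 ∎

  x≤x⊕y : ∀ x y → x ≤ x ⊕ y
  x≤x⊕y x y = begin
    ¬ x ⊕ (x ⊕ y)  ≡⟨ sym (⊕-assoc (¬ x) x y) ⟩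
    (¬ x ⊕ x) ⊕ y  ≡⟨ cong (_⊕ y) (≤-refl x) ⟩
    1# ⊕ y         ≡⟨ ⊕-zeroˡ y ⟩
    1#             ∎

  ≤⇒∨≡ : ∀ {x y} → x ≤ y → x ∨ y ≡ y
  ≤⇒∨≡ {x} {y} x≤y = begin
    ¬ (¬ x ⊕ y) ⊕ y  ≡⟨ cong (λ t → ¬ t ⊕ y) x≤y ⟩
    ¬ 1# ⊕ y         ≡⟨ cong (_⊕ y) ¬1≡0 ⟩
    0# ⊕ y           ≡⟨ ⊕-identityˡ y ⟩
    y                ∎

  ≤⇒≡⊕ : ∀ {x y} → x ≤ y → y ≡ x ⊕ ¬ (¬ y ⊕ x)
  ≤⇒≡⊕ {x} {y} x≤y = begin
    y                ≡⟨ sym (≤⇒∨≡ x≤y) ⟩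
    ¬ (¬ x ⊕ y) ⊕ y  ≡⟨ łuk x y ⟩
    ¬ (¬ y ⊕ x) ⊕ x  ≡⟨ ⊕-comm _ x ⟩
    x ⊕ ¬ (¬ y ⊕ x)  ∎

  ≤-antisym : ∀ {x y} → x ≤ y → y ≤ x → x ≡ y
  ≤-antisym {x} {y} x≤y y≤x = trans (sym (≤⇒∨≡ y≤x)) (trans (łuk y x) (≤⇒∨≡ x≤y))

  ≤-trans : ∀ {x y z} → x ≤ y → y ≤ z → x ≤ z
  ≤-trans {x} {y} {z} x≤y y≤z = subst (x ≤_) (sym z≡x⊕d) (x≤x⊕y x _)
    where
    z≡x⊕d : z ≡ x ⊕ (¬ (¬ y ⊕ x) ⊕ ¬ (¬ z ⊕ y))
    z≡x⊕d = begin
      z                                    ≡⟨ ≤⇒≡⊕ y≤z ⟩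
      y ⊕ ¬ (¬ z ⊕ y)                      ≡⟨ cong (_⊕ ¬ (¬ z ⊕ y)) (≤⇒≡⊕ x≤y) ⟩
      (x ⊕ ¬ (¬ y ⊕ x)) ⊕ ¬ (¬ z ⊕ y)      ≡⟨ ⊕-assoc x _ _ ⟩
      x ⊕ (¬ (¬ y ⊕ x) ⊕ ¬ (¬ z ⊕ y))      ∎

  ≥1⇒≡1 : ∀ {x} → 1# ≤ x → x ≡ 1#
  ≥1⇒≡1 {x} = ≤-antisym (subst (x ≤_) (⊕-¬0 x) (x≤x⊕y x (¬ 0#)))

  0≤x : ∀ x → 0# ≤ x
  0≤x = ⊕-zeroˡ

  ⊕-monoʳ-≤ : ∀ z {x y} → x ≤ y → z ⊕ x ≤ z ⊕ y
  ⊕-monoʳ-≤ z {x} {y} x≤y = subst (z ⊕ x ≤_) (sym z⊕y≡z⊕x⊕d) (x≤x⊕y (z ⊕ x) d)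
    where
    d : Carrier
    d = ¬ (¬ y ⊕ x)
    z⊕y≡z⊕x⊕d : z ⊕ y ≡ (z ⊕ x) ⊕ d
    z⊕y≡z⊕x⊕d = trans (cong (z ⊕_) (≤⇒≡⊕ x≤y)) (sym (⊕-assoc z x d))

  ⊕-monoˡ-≤ : ∀ z {x y} → x ≤ y → x ⊕ z ≤ y ⊕ z
  ⊕-monoˡ-≤ z {x} {y} x≤y = subst₂ _≤_ (⊕-comm z x) (⊕-comm z y) (⊕-monoʳ-≤ z x≤y)

  ¬-antitone : ∀ {x y} → x ≤ y → ¬ y ≤ ¬ x
  ¬-antitone {x} {y} x≤y = trans (cong (_⊕ ¬ x) (¬¬ y)) (trans (⊕-comm y (¬ x)) x≤y)

  ∨-least : ∀ {x y u} → x ≤ u → y ≤ u → x ∨ y ≤ u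
  ∨-least {x} {y} {u} x≤u y≤u = subst (x ∨ y ≤_) (trans (łuk u y) (≤⇒∨≡ y≤u))
    (⊕-monoˡ-≤ y (¬-antitone (⊕-monoˡ-≤ y (¬-antitone x≤u))))

  ⋁fin-least : ∀ {F u} → All (_≤ u) F → ⋁fin F ≤ u
  ⋁fin-least []          = 0≤x _
  ⋁fin-least (f≤u ∷ F≤u) = ∨-least f≤u (⋁fin-least F≤u)

  _⊙_ : Carrier → Carrier → Carrier
  x ⊙ y = ¬ (¬ x ⊕ ¬ y)

  ⊙-monoʳ-≤ : ∀ z {x y} → x ≤ y → z ⊙ x ≤ z ⊙ y
  ⊙-monoʳ-≤ z x≤y = ¬-antitone (⊕-monoʳ-≤ (¬ z) (¬-antitone x≤y))

  ⊙-residual : ∀ {x y z} → x ⊙ y ≤ z → x ≤ ¬ y ⊕ z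
  ⊙-residual {x} {y} {z} p = trans (sym (⊕-assoc _ _ _)) (trans (cong (_⊕ z) (sym (¬¬ _))) p)

  ⊙-unresidual : ∀ {x y z} → x ≤ ¬ y ⊕ z → x ⊙ y ≤ z
  ⊙-unresidual {x} {y} {z} p = trans (cong (_⊕ z) (¬¬ _)) (trans (⊕-assoc _ _ _) p)

  ∧≡⊙ : ∀ x y → x ∧ y ≡ y ⊙ (¬ y ⊕ x)
  ∧≡⊙ x y = cong ¬_ (begin
    ¬ (¬ (¬ x) ⊕ ¬ y) ⊕ ¬ y  ≡⟨ ⊕-comm _ (¬ y) ⟩
    ¬ y ⊕ ¬ (¬ (¬ x) ⊕ ¬ y)  ≡⟨ cong (λ t → ¬ y ⊕ ¬ (t ⊕ ¬ y)) (¬¬ x) ⟩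
    ¬ y ⊕ ¬ (x ⊕ ¬ y)        ≡⟨ cong (λ t → ¬ y ⊕ ¬ t) (⊕-comm x (¬ y)) ⟩
    ¬ y ⊕ ¬ (¬ y ⊕ x)        ∎)

  ∧-comm : ∀ x y → x ∧ y ≡ y ∧ x
  ∧-comm x y = cong ¬_ (łuk (¬ x) (¬ y))

  ∧-monoʳ-≤ : ∀ x {y z} → y ≤ z → x ∧ y ≤ x ∧ z
  ∧-monoʳ-≤ x {y} {z} y≤z =
    subst₂ _≤_ (sym (trans (∧-comm x y) (∧≡⊙ y x))) (sym (trans (∧-comm x z) (∧≡⊙ z x)))
      (⊙-monoʳ-≤ x (⊕-monoʳ-≤ (¬ x) y≤z))

  SupIn-restrict : ∀ {ℓ} {P : Pred} {S : Carrier → Set ℓ} {m} →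
                   P m → SupIn Full S m → SupIn P S m
  SupIn-restrict Pm (_ , upper , least) = Pm , upper , λ u _ → least u tt

module SubMVAlgebra {c : Level} (A : MVAlgebra c) (P : MVAlgebra.Pred A)
  (¬-closed : ∀ x → P x → P (MVAlgebra.¬_ A x))
  (⊕-closed : ∀ x y → P x → P y → P (MVAlgebra._⊕_ A x y)) where
  open MVAlgebra A
  open MVProperties A

  ∨-closed : ∀ x y → P x → P y → P (x ∨ y)
  ∨-closed x y Px Py = ⊕-closed _ y (¬-closed _ (⊕-closed _ y (¬-closed x Px) Py)) Py

  ∧-closed : ∀ x y → P x → P y → P (x ∧ y)
  ∧-closed x y Px Py = ¬-closed _ (∨-closed _ _ (¬-closed x Px) (¬-closed y Py))

  ⋁fin-closed : ∀ {F} → P 0# → All P F → P (⋁fin F)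
  ⋁fin-closed P0 []         = P0
  ⋁fin-closed P0 (Pf ∷ PF) = ∨-closed _ _ Pf (⋁fin-closed P0 PF)

  frame : FrameIn P
  frame x S s Px _ (Ps , s-upper , s-least) = ∧-closed x s Px Ps , upper , least
    where
    upper : ∀ y → ∃[ z ] (S z × y ≡ x ∧ z) → y ≤ x ∧ s
    upper _ (z , Sz , refl) = ∧-monoʳ-≤ x (s-upper z Sz)

    w : Carrier
    w = ¬ s ⊕ x

    least : ∀ u → P u → (∀ y → ∃[ z ] (S z × y ≡ x ∧ z) → y ≤ u) → x ∧ s ≤ u
    least u Pu bound = subst (_≤ u) (sym (∧≡⊙ x s)) (⊙-unresidual s≤¬w⊕u)
      where
      z⊙w≤u : ∀ z → S z → z ⊙ w ≤ u
      z⊙w≤u z Sz = ≤-trans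
        (subst (z ⊙ w ≤_) (sym (∧≡⊙ x z)) (⊙-monoʳ-≤ z (⊕-monoˡ-≤ x (¬-antitone (s-upper z Sz)))))
        (bound (x ∧ z) (z , Sz , refl))

      s≤¬w⊕u : s ≤ ¬ w ⊕ u
      s≤¬w⊕u = s-least (¬ w ⊕ u)
        (⊕-closed _ u (¬-closed w (⊕-closed _ x (¬-closed s Ps) Px)) Pu)
        (λ z Sz → ⊙-residual (z⊙w≤u z Sz))

module InductiveClosure {c : Level} (A : MVAlgebra c) (complete : MVAlgebra.IsComplete A)
  (j : MVAlgebra.Carrier A → MVAlgebra.Carrier A) (isClosure : MVAlgebra.IsClosureOperator A j)
  (isInductive : MVAlgebra.IsInductive A j) (isMVType : MVAlgebra.IsMVType A j) where
  open MVAlgebra A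
  open MVProperties A
  open SubMVAlgebra A (Fix j) (proj₁ isMVType) (proj₂ isMVType)

  extensive : ∀ x → x ≤ j x
  extensive = proj₁ isClosure

  idempotent : ∀ x → j (j x) ≡ j x
  idempotent = proj₂ (proj₂ isClosure)

  j-least : ∀ {x u} → Fix j u → x ≤ u → j x ≤ u
  j-least {x} {u} fixed x≤u = subst (j x ≤_) fixed (proj₁ (proj₂ isClosure) x u x≤u)

  j-inductive-least : ∀ {x u} → (∀ a → Compact a → a ≤ x → j a ≤ u) → j x ≤ u
  j-inductive-least {x} {u} bound =
    proj₂ (proj₂ (isInductive x)) u tt λ { _ (a , ca , a≤x , refl) → bound a ca a≤x }

  fix-0 : Fix j 0#
  fix-0 = subst (Fix j) ¬1≡0 (proj₁ isMVType 1# (≥1⇒≡1 (extensive 1#)))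

  fix-⋁fin : ∀ {F} → All (Fix j) F → Fix j (⋁fin F)
  fix-⋁fin = ⋁fin-closed fix-0

  sup-fixed : ∀ {S m} → S ⊆ Fix j → SupIn Full S m → Fix j m
  sup-fixed {S} {m} S⊆Fix m-sup@(_ , m-upper , _) =
    ≤-antisym (j-inductive-least compact-bound) (extensive m)
    where
    compact-bound : ∀ b → Compact b → b ≤ m → j b ≤ m
    compact-bound b (_ , b-compact) b≤m
      with b-compact S m (λ _ _ → tt) m-sup b≤m
    ... | F , SF , b≤⋁F = ≤-trans (j-least (fix-⋁fin (All.map (S⊆Fix _) SF)) b≤⋁F)
                                  (⋁fin-least (All.map (m-upper _) SF))

  complete-Fix : CompleteIn (Fix j)
  complete-Fix S S⊆Fix with complete S (λ _ _ → tt)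
  ... | m , m-sup = m , SupIn-restrict (sup-fixed S⊆Fix m-sup) m-sup

  j-compact : ∀ {a} → Compact a → CompactIn (Fix j) (j a)
  j-compact {a} (_ , a-compact) = idempotent a , compact
    where
    compact : ∀ (S : Pred) s → S ⊆ Fix j → SupIn (Fix j) S s → j a ≤ s →
              ∃[ F ] (All S F × j a ≤ ⋁fin F)
    compact S s S⊆Fix (_ , _ , s-least) ja≤s with complete S (λ _ _ → tt)
    ... | m , m-sup@(_ , m-upper , _)
      with a-compact S m (λ _ _ → tt) m-sup
             (≤-trans (extensive a) (≤-trans ja≤s (s-least m (sup-fixed S⊆Fix m-sup) m-upper)))
    ... | F , SF , a≤⋁F = F , SF , j-least (fix-⋁fin (All.map (S⊆Fix _) SF)) a≤⋁F

  algebraic-Fix : AlgebraicIn (Fix j)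
  algebraic-Fix x fixed = fixed , (λ _ → proj₂) , least
    where
    least : ∀ u → Fix j u → (∀ a → CompactIn (Fix j) a × a ≤ x → a ≤ u) → x ≤ u
    least u _ bound = subst (_≤ u) fixed
      (j-inductive-least λ a ca a≤x → bound (j a) (j-compact ca , j-least fixed a≤x))

proposition3p7 : {c : Level} (A : MVAlgebra c) → let open MVAlgebra A in
    IsComplete → (j : Carrier → Carrier) → IsNucleus j → IsInductive j → IsMVType j →
    IsSubMV (Fix j) × CompleteIn (Fix j) × FrameIn (Fix j) × AlgebraicIn (Fix j)
proposition3p7 A complete j nucleus isInductive isMVType =
  (fix-0 , isMVType) , complete-Fix , frame , algebraic-Fix
  where
  open MVAlgebra A using (Fix)
  open InductiveClosure A complete j (proj₁ nucleus) isInductive isMVType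
  open SubMVAlgebra A (Fix j) (proj₁ isMVType) (proj₂ isMVType) using (frame)
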